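{- Let $G$ be a connected simple graph and $C$ a cycle of $G$. If $|C|=2k+1$ with $k\ge 1$, then $C$ is convex if and only if for every edge $e=xy$ of $C$ there exists a vertex $v\in C$ such that (i) $d_G(x,v)=d_G(y,v)=k$, and (ii) the $x,v$-path (resp. $y,v$-path) on $C$ of length $k$ is the unique shortest $x,v$-path (resp. $y,v$-path) in $G$. If $|C|=2k$ with $k\ge 2$, then $C$ is convex if and only if for every vertex $u\in C$ there exists a vertex $v\in C$ such that (iii) $d_G(u,v)=k$, and (iv) there are precisely two $u,v$-paths in $G$ of length $k$.
   Context: $d_G$ is the shortest-path distance in $G$. A subgraph $H$ of $G$ is convex if for any $u,v\in V(H)$, every shortest $u,v$-path in $G$ lies completely in $H$; a cycle is convex if it is a convex subgraph. -}

module Defs where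

open import Data.Nat using (ℕ; zero; suc; _+_; _*_; _≤_)
open import Data.Fin using (Fin; toℕ)
open import Data.Bool using (Bool; true; false)
open import Data.Vec using (Vec; []; _∷_; head; last; lookup)
open import Data.Vec.Relation.Unary.All using (All)
open import Data.Product using (Σ; ∃; _×_; _,_)
open import Data.Sum using (_⊎_)
open import Data.Unit using (⊤)
open import Function.Definitions using (Injective)
open import Relation.Binary.PropositionalEquality using (_≡_; _≢_)

record Graph (n : ℕ) : Set where
  field
    adj    : Fin n → Fin n → Bool
    sym    : ∀ u v → adj u v ≡ adj v u
    irrefl : ∀ u → adj u u ≡ false
open Graph public

module _ {n : ℕ} (G : Graph n) where

  Edge : Fin n → Fin n → Set
  Edge u v = adj G u v ≡ true

-- Walks and paths, represented by their vertex sequence.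
-- A vector of l+1 vertices represents a walk of length l.

Chain : ∀ {n} → (Fin n → Fin n → Set) → ∀ {l} → Vec (Fin n) (suc l) → Set
Chain R (x ∷ [])     = ⊤
Chain R (x ∷ y ∷ xs) = R x y × Chain R (y ∷ xs)

module _ {n : ℕ} (G : Graph n) where

  IsWalk : Fin n → Fin n → (l : ℕ) → Vec (Fin n) (suc l) → Set
  IsWalk u v l p = head p ≡ u × last p ≡ v × Chain (Edge G) p

  IsPath : Fin n → Fin n → (l : ℕ) → Vec (Fin n) (suc l) → Set
  IsPath u v l p = IsWalk u v l p × Injective _≡_ _≡_ (lookup p)

  Dist : Fin n → Fin n → ℕ → Set
  Dist u v d = (Σ (Vec (Fin n) (suc d)) λ p → IsPath u v d p)
             × (∀ l (p : Vec (Fin n) (suc l)) → IsWalk u v l p → d ≤ l)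

  IsShortestPath : Fin n → Fin n → (l : ℕ) → Vec (Fin n) (suc l) → Set
  IsShortestPath u v l p = IsPath u v l p × Dist u v l

  Connected : Set
  Connected = ∀ u v → Σ ℕ λ l → Σ (Vec (Fin n) (suc l)) λ p → IsWalk u v l p

-- Cycles.  A cycle of length m is given by its vertices c₀,…,c_{m-1}
-- (indexed by Fin m), pairwise distinct, with c_i c_{i+1 mod m} ∈ E(G).

NextIdx : ∀ {m} → Fin m → Fin m → Set
NextIdx {m} i j = (suc (toℕ i) ≡ toℕ j) ⊎ (suc (toℕ i) ≡ m × toℕ j ≡ 0)

record Cycle {n : ℕ} (G : Graph n) (m : ℕ) : Set where
  field
    length≥3 : 3 ≤ m
    vtx      : Fin m → Fin n
    distinct : Injective _≡_ _≡_ vtx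
    edges    : ∀ i j → NextIdx i j → Edge G (vtx i) (vtx j)
open Cycle public

module _ {n : ℕ} {G : Graph n} {m : ℕ} (C : Cycle G m) where

  InC : Fin n → Set
  InC a = Σ (Fin m) λ i → vtx C i ≡ a

  CEdge : Fin n → Fin n → Set
  CEdge a b = Σ (Fin m) λ i → Σ (Fin m) λ j → NextIdx i j ×
              ((a ≡ vtx C i × b ≡ vtx C j) ⊎ (a ≡ vtx C j × b ≡ vtx C i))

  LiesIn : ∀ {l} → Vec (Fin n) (suc l) → Set
  LiesIn p = All InC p × Chain CEdge p

  Convex : Set
  Convex = ∀ u v → InC u → InC v →
           ∀ l (p : Vec (Fin n) (suc l)) → IsShortestPath G u v l p → LiesIn p

  CPathUniqueShortest : Fin n → Fin n → ℕ → Set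
  CPathUniqueShortest x v k =
    Σ (Vec (Fin n) (suc k)) λ P → IsPath G x v k P × LiesIn P ×
      (∀ l (Q : Vec (Fin n) (suc l)) → IsShortestPath G x v l Q →
         Σ (l ≡ k) λ { _≡_.refl → Q ≡ P })

  OddCondition : ℕ → Set
  OddCondition k = ∀ i j → NextIdx i j →
    Σ (Fin m) λ t →
      Dist G (vtx C i) (vtx C t) k × Dist G (vtx C j) (vtx C t) k ×
      CPathUniqueShortest (vtx C i) (vtx C t) k ×
      CPathUniqueShortest (vtx C j) (vtx C t) k

  ExactlyTwoPaths : Fin n → Fin n → ℕ → Set
  ExactlyTwoPaths u v k =
    Σ (Vec (Fin n) (suc k)) λ P₁ → Σ (Vec (Fin n) (suc k)) λ P₂ →
      IsPath G u v k P₁ × IsPath G u v k P₂ × P₁ ≢ P₂ ×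
      (∀ (Q : Vec (Fin n) (suc k)) → IsPath G u v k Q → (Q ≡ P₁ ⊎ Q ≡ P₂))

  EvenCondition : ℕ → Set
  EvenCondition k = ∀ s → Σ (Fin m) λ t →
    Dist G (vtx C s) (vtx C t) k × ExactlyTwoPaths (vtx C s) (vtx C t) k

-- Number the vertices of C cyclically, so that a C-path from a is an arc next^0 a, …, next^l a or
-- the same backwards. If C is convex, every geodesic between vertices of C is such an arc; on an
-- odd cycle of length 2k+1 this makes the forward arc of length k from a the unique geodesic to
-- next^k a (for an edge xy the apex is prev^k x = next^k y), and on an even cycle of length 2k the
-- two arcs of length k to the antipode are the only paths of that length.
-- Conversely, either condition says that for every a the end of each arc of length k from a is at
-- distance k and every geodesic to it lies in C. A geodesic from a to a vertex j ≤ k steps ahead,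
-- prolonged along C to the end of that arc, is then a geodesic of length k, so it lies in C; and as
-- the cycle has at most 2k+1 vertices, every vertex is at most k steps from a in one direction.

module Submission where

open import Data.Bool using (true)
import Data.Bool.Properties as Bool
open import Data.Empty using (⊥-elim)
open import Data.Fin as Fin using (Fin; zero; suc; toℕ)
import Data.Fin.Properties as Fin
open import Data.Nat using (ℕ; zero; suc; pred; _+_; _*_; _∸_; _≤_; _<_; _≤?_; _<?_; z≤n; s≤s; z<s; NonZero)
open import Data.Nat.DivMod
open import Data.Nat.GeneralisedArithmetic using (iterate)
open import Data.Nat.Properties
open import Data.Product using (Σ; _×_; _,_; proj₁; proj₂)
open import Data.Sum using (_⊎_; inj₁; inj₂)
import Data.Sum as Sum
open import Data.Unit using (tt)
open import Data.Vec using (Vec; []; _∷_; head; last; lookup; tail; _++_)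
open import Data.Vec.Relation.Unary.All using (All; []; _∷_)
import Data.Vec.Relation.Unary.All.Properties as All
open import Function.Base using (id; _∘′_; case_of_)
open import Function.Bundles using (_⇔_; mk⇔)
open import Function.Definitions using (Injective)
open import Relation.Binary.Definitions using (tri<; tri≈; tri>)
open import Relation.Binary.PropositionalEquality
open import Relation.Nullary using (Dec; yes; no)
open import Relation.Nullary.Decidable using (_×-dec_)

open import Defs hiding (sym)

least : (P : ℕ → Set) → (∀ k → Dec (P k)) → ∀ {L} → P L →
        Σ ℕ λ d → P d × (∀ {d'} → P d' → d ≤ d')
least P P? {zero} p = zero , p , λ _ → z≤n
least P P? {suc L} p with P? zero
... | yes p₀ = zero , p₀ , λ _ → z≤n
... | no ¬p₀ with least (λ k → P (suc k)) (λ k → P? (suc k)) p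
...   | d , pd , minimal = suc d , pd , above
  where
  above : ∀ {d'} → P d' → suc d ≤ d'
  above {zero}   p₀ = ⊥-elim (¬p₀ p₀)
  above {suc d'} p' = s≤s (minimal p')

lookup-∷-injective : ∀ {A : Set} {l} {x : A} {xs : Vec A l} →
                     Injective _≡_ _≡_ (lookup (x ∷ xs)) → Injective _≡_ _≡_ (lookup xs)
lookup-∷-injective injective {i} {j} xsᵢ≡xsⱼ = Fin.suc-injective (injective {suc i} {suc j} xsᵢ≡xsⱼ)

module Walks {n : ℕ} (G : Graph n) where

  walk-∷ : ∀ {x y v l} {q : Vec (Fin n) (suc l)} → Edge G x y → IsWalk G y v l q →
           IsWalk G x v (suc l) (x ∷ q)
  walk-∷ {q = _ ∷ _} e (refl , ends , chain) = refl , ends , e , chain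

  walk-++ : ∀ {u w v a b} {p : Vec (Fin n) (suc a)} {q : Vec (Fin n) (suc b)} →
            IsWalk G u w a p → IsWalk G w v b q → IsWalk G u v (a + b) (p ++ tail q)
  walk-++ {p = _ ∷ []}    {q = _ ∷ _} (refl , refl , tt) wq@(refl , _) = wq
  walk-++ {p = _ ∷ _ ∷ _} (refl , ends , e , chain) wq = walk-∷ e (walk-++ (refl , ends , chain) wq)

  walk-suffix : ∀ {l} (p : Vec (Fin n) (suc l)) (i : Fin (suc l)) → Chain (Edge G) p →
                Σ ℕ λ l' → l' ≤ l × Σ (Vec (Fin n) (suc l')) (IsWalk G (lookup p i) (last p) l')
  walk-suffix {l} (x ∷ xs) zero chain = l , ≤-refl , x ∷ xs , refl , refl , chain
  walk-suffix (_ ∷ y ∷ ys) (suc i) (_ , chain) with walk-suffix (y ∷ ys) i chain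
  ... | l' , l'≤l , q , wq = l' , m≤n⇒m≤1+n l'≤l , q , wq

  walk-shortcut : ∀ {l u v} (p : Vec (Fin n) (suc l)) → IsWalk G u v l p → (i j : Fin (suc l)) →
                  toℕ i < toℕ j → lookup p i ≡ lookup p j →
                  Σ ℕ λ l' → l' < l × Σ (Vec (Fin n) (suc l')) (IsWalk G u v l')
  walk-shortcut (_ ∷ y ∷ ys) (refl , ends , _ , chain) zero (suc j) _ pᵢ≡pⱼ
    with walk-suffix (y ∷ ys) j chain
  ... | l' , l'≤l , q , (start , end , chain') =
        l' , s≤s l'≤l , q , trans start (sym pᵢ≡pⱼ) , trans end ends , chain'
  walk-shortcut (_ ∷ y ∷ ys) (refl , ends , e , chain) (suc i) (suc j) (s≤s i<j) pᵢ≡pⱼ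
    with walk-shortcut (y ∷ ys) (refl , ends , chain) i j i<j pᵢ≡pⱼ
  ... | l' , l'<l , q , wq = suc l' , s≤s l'<l , _ , walk-∷ e wq

  minimal-walk-injective : ∀ {u v d} {p : Vec (Fin n) (suc d)} →
    (∀ l (q : Vec (Fin n) (suc l)) → IsWalk G u v l q → d ≤ l) →
    IsWalk G u v d p → Injective _≡_ _≡_ (lookup p)
  minimal-walk-injective {p = p} minimal wp {i} {j} pᵢ≡pⱼ with <-cmp (toℕ i) (toℕ j)
  ... | tri≈ _ i≡j _ = Fin.toℕ-injective i≡j
  ... | tri< i<j _ _ = let l' , l'<d , q , wq = walk-shortcut p wp i j i<j pᵢ≡pⱼ
                       in ⊥-elim (<⇒≱ l'<d (minimal l' q wq))
  ... | tri> _ _ j<i = let l' , l'<d , q , wq = walk-shortcut p wp j i j<i (sym pᵢ≡pⱼ)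
                       in ⊥-elim (<⇒≱ l'<d (minimal l' q wq))

  WalkOfLength : Fin n → Fin n → ℕ → Set
  WalkOfLength u v l = Σ (Vec (Fin n) (suc l)) (IsWalk G u v l)

  walkOfLength? : ∀ l u v → Dec (WalkOfLength u v l)
  walkOfLength? zero u v with u Fin.≟ v
  ... | yes u≡v = yes (_ , refl , u≡v , tt)
  ... | no u≢v  = no λ { ((_ ∷ []) , refl , u≡v , _) → u≢v u≡v }
  walkOfLength? (suc l) u v with Fin.any? (λ w → (adj G u w Bool.≟ true) ×-dec walkOfLength? l w v)
  ... | yes (w , e , q , wq) = yes (_ , walk-∷ e wq)
  ... | no ∄w = no λ { ((_ ∷ y ∷ ys) , refl , end , e , chain) → ∄w (y , e , _ , refl , end , chain) }

  dist-exists : ∀ {u v l} {p : Vec (Fin n) (suc l)} → IsWalk G u v l p → Σ ℕ (Dist G u v)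
  dist-exists {u} {v} wp with least (WalkOfLength u v) (λ l → walkOfLength? l u v) (_ , wp)
  ... | d , (q , wq) , minimal =
        d , (q , wq , minimal-walk-injective minimal′ wq) , minimal′
    where minimal′ = λ l r wr → minimal (r , wr)

  dist-unique : ∀ {u v d d'} → Dist G u v d → Dist G u v d' → d ≡ d'
  dist-unique ((p , (wp , _)) , minimal) ((p' , (wp' , _)) , minimal') =
    ≤-antisym (minimal _ p' wp') (minimal' _ p wp)

module _ (k : ℕ) where

  2k≡k+k : 2 * k ≡ k + k
  2k≡k+k = cong (k +_) (+-identityʳ k)

  2k+1≡1+k+k : 2 * k + 1 ≡ suc (k + k)
  2k+1≡1+k+k = trans (+-comm (2 * k) 1) (cong suc 2k≡k+k)

  k<2k+1 : k < 2 * k + 1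
  k<2k+1 = subst (k <_) (sym 2k+1≡1+k+k) (s≤s (m≤m+n k k))

  k<2k : 1 ≤ k → k < 2 * k
  k<2k 1≤k = subst (k <_) (sym 2k≡k+k) (m<m+n k 1≤k)

  [2k+1]∸k≡1+k : 2 * k + 1 ∸ k ≡ suc k
  [2k+1]∸k≡1+k = trans (cong (_∸ k) (trans 2k+1≡1+k+k (sym (+-suc k k)))) (m+n∸m≡n k (suc k))

  2k∸k≡k : 2 * k ∸ k ≡ k
  2k∸k≡k = trans (cong (_∸ k) 2k≡k+k) (m+n∸m≡n k k)

  d+k≢2k+1 : ∀ {d} → d ≤ k → d + k ≢ 2 * k + 1
  d+k≢2k+1 d≤k d+k≡ = <-irrefl (trans d+k≡ 2k+1≡1+k+k) (s≤s (+-monoˡ-≤ k d≤k))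

  d+k≡2k⇒d≡k : ∀ {d} → d + k ≡ 2 * k → d ≡ k
  d+k≡2k⇒d≡k {d} d+k≡ = +-cancelʳ-≡ k d k (trans d+k≡ 2k≡k+k)

  ≤2k+1⇒∸≤k : ∀ {m j} → m ≤ 2 * k + 1 → k < j → m ∸ j ≤ k
  ≤2k+1⇒∸≤k {m} m≤ k<j = ≤-trans (∸-monoʳ-≤ m k<j)
    (≤-trans (∸-monoˡ-≤ (suc k) m≤) (≤-reflexive (trans (cong (_∸ suc k) 2k+1≡1+k+k) (m+n∸n≡m k k))))

  ≡2k⇒≤k : ∀ {m e} → m ≡ 2 * k → e ≤ m → k ≤ m ∸ e → e ≤ k
  ≡2k⇒≤k {m} {e} m≡2k e≤m k≤m∸e = +-cancelʳ-≤ k e k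
    (≤-trans (+-monoʳ-≤ e k≤m∸e) (≤-reflexive (trans (m+[n∸m]≡n e≤m) (trans m≡2k 2k≡k+k))))

module _ {I : Set} (f : I → I) where

  iterate-+ : ∀ x a b → iterate f x (a + b) ≡ iterate f (iterate f x a) b
  iterate-+ x zero    b = refl
  iterate-+ x (suc a) b = iterate-+ (f x) a b

  iterate-suc : ∀ x k → iterate f x (suc k) ≡ f (iterate f x k)
  iterate-suc x zero    = refl
  iterate-suc x (suc k) = iterate-suc (f x) k

record IsCyclicPermutation {I : Set} (f g : I → I) (m : ℕ) : Set where
  field
    left-inverse  : ∀ x → g (f x) ≡ x
    right-inverse : ∀ x → f (g x) ≡ x
    period        : ∀ x → iterate f x m ≡ x
    aperiodic     : ∀ {d} x → 0 < d → d < m → iterate f x d ≢ x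
    transitive    : ∀ a b → Σ ℕ λ j → j < m × iterate f a j ≡ b

module CyclicPermutation {I : Set} {f g : I → I} {m : ℕ} (cyclic : IsCyclicPermutation f g m) where
  open IsCyclicPermutation cyclic public

  iterate-right-inverse : ∀ x k → iterate f (iterate g x k) k ≡ x
  iterate-right-inverse x zero    = refl
  iterate-right-inverse x (suc k) = begin
    iterate f (iterate g (g x) k) (suc k)   ≡⟨ iterate-suc f _ k ⟩
    f (iterate f (iterate g (g x) k) k)     ≡⟨ cong f (iterate-right-inverse (g x) k) ⟩
    f (g x)                                 ≡⟨ right-inverse x ⟩
    x                                       ∎
    where open ≡-Reasoning

  iterate-injective : ∀ {x e e'} → e < m → e' < m → iterate f x e ≡ iterate f x e' → e ≡ e'
  iterate-injective {x} {e} {e'} e<m e'<m fᵉx≡fᵉ'x with <-cmp e e'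
  ... | tri≈ _ e≡e' _ = e≡e'
  ... | tri< e<e' _ _ = ⊥-elim (aperiodic (iterate f x e) (m<n⇒0<n∸m e<e') (≤-<-trans (m∸n≤m e' e) e'<m)
          (trans (sym (iterate-+ f x e (e' ∸ e)))
                 (trans (cong (iterate f x) (m+[n∸m]≡n (<⇒≤ e<e'))) (sym fᵉx≡fᵉ'x))))
  ... | tri> _ _ e'<e = ⊥-elim (aperiodic (iterate f x e') (m<n⇒0<n∸m e'<e) (≤-<-trans (m∸n≤m e e') e<m)
          (trans (sym (iterate-+ f x e' (e ∸ e')))
                 (trans (cong (iterate f x) (m+[n∸m]≡n (<⇒≤ e'<e))) fᵉx≡fᵉ'x)))

  iterate-inverse : ∀ x {j} → j ≤ m → iterate g x j ≡ iterate f x (m ∸ j)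
  iterate-inverse x {j} j≤m = sym (begin
    iterate f x (m ∸ j)                    ≡⟨ cong (λ y → iterate f y (m ∸ j)) (iterate-right-inverse x j) ⟨
    iterate f (iterate f y j) (m ∸ j)      ≡⟨ iterate-+ f y j (m ∸ j) ⟨
    iterate f y (j + (m ∸ j))              ≡⟨ cong (iterate f y) (m+[n∸m]≡n j≤m) ⟩
    iterate f y m                          ≡⟨ period y ⟩
    y                                      ∎)
    where
    open ≡-Reasoning
    y = iterate g x j

  iterate-complement : ∀ x {j} → j ≤ m → iterate g x (m ∸ j) ≡ iterate f x j
  iterate-complement x {j} j≤m =
    trans (iterate-inverse x (m∸n≤m m j)) (cong (iterate f x) (m∸[m∸n]≡n j≤m))

  backward-meets-forward : ∀ x {d k} → d ≤ k → 0 < k → k < m →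
                           iterate g x d ≡ iterate f x k → d + k ≡ m
  backward-meets-forward x {zero}  _   0<k k<m x≡fᵏx = ⊥-elim (aperiodic x 0<k k<m (sym x≡fᵏx))
  backward-meets-forward x {suc d} {k} d≤k _ k<m gᵈx≡fᵏx =
    trans (cong (suc d +_) (sym m∸d≡k)) (m+[n∸m]≡n d≤m)
    where
    d≤m = ≤-trans d≤k (<⇒≤ k<m)
    m∸d≡k = iterate-injective (∸-monoʳ-< {o = 0} z<s d≤m) k<m
              (trans (sym (iterate-inverse x d≤m)) gᵈx≡fᵏx)

  odd-antipode : ∀ x {k} → m ≡ 2 * k + 1 → iterate g x k ≡ iterate f (f x) k
  odd-antipode x {k} m≡2k+1 = trans (iterate-inverse x (<⇒≤ (subst (k <_) (sym m≡2k+1) (k<2k+1 k))))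
                                    (cong (iterate f x) (trans (cong (_∸ k) m≡2k+1) ([2k+1]∸k≡1+k k)))

  even-antipode : ∀ x {k} → 1 ≤ k → m ≡ 2 * k → iterate g x k ≡ iterate f x k
  even-antipode x {k} 1≤k m≡2k = trans (iterate-inverse x (<⇒≤ (subst (k <_) (sym m≡2k) (k<2k k 1≤k))))
                                       (cong (iterate f x) (trans (cong (_∸ k) m≡2k) (2k∸k≡k k)))

  reverse : IsCyclicPermutation g f m
  reverse = record
    { left-inverse  = right-inverse
    ; right-inverse = left-inverse
    ; period        = λ x → trans (iterate-inverse x ≤-refl) (cong (iterate f x) (n∸n≡0 m))
    ; aperiodic     = λ {d} x 0<d d<m gᵈx≡x → aperiodic x 0<d d<m
        (trans (cong (λ y → iterate f y d) (sym gᵈx≡x)) (iterate-right-inverse x d))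
    ; transitive    = transitive-g
    }
    where
    transitive-g : ∀ a b → Σ ℕ λ j → j < m × iterate g a j ≡ b
    transitive-g a b with transitive a b
    ... | zero  , 0<m , a≡b  = zero , 0<m , a≡b
    ... | suc j , j<m , fʲa≡b = m ∸ suc j , ∸-monoʳ-< {o = 0} z<s (<⇒≤ j<m) ,
          trans (iterate-complement a (<⇒≤ j<m)) fʲa≡b

module Rotation (m : ℕ) .{{_ : NonZero m}} where

  shift : ℕ → Fin m → Fin m
  shift e i = (toℕ i + e) mod m

  next prev : Fin m → Fin m
  next = shift 1
  prev = shift (pred m)

  toℕ-shift : ∀ e i → toℕ (shift e i) ≡ (toℕ i + e) % m
  toℕ-shift e i = Fin.toℕ-fromℕ< _

  toℕ-next : ∀ i → toℕ (next i) ≡ suc (toℕ i) % m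
  toℕ-next i = trans (toℕ-shift 1 i) (cong (_% m) (+-comm (toℕ i) 1))

  toℕ[i]%m≡toℕ[i] : ∀ (i : Fin m) → toℕ i % m ≡ toℕ i
  toℕ[i]%m≡toℕ[i] i = m<n⇒m%n≡m (Fin.toℕ<n i)

  [a%m+b]%m≡[a+b]%m : ∀ a b → (a % m + b) % m ≡ (a + b) % m
  [a%m+b]%m≡[a+b]%m a b = begin
    (a % m + b) % m          ≡⟨ %-distribˡ-+ (a % m) b m ⟩
    (a % m % m + b % m) % m  ≡⟨ cong (λ c → (c + b % m) % m) (m%n%n≡m%n a m) ⟩
    (a % m + b % m) % m      ≡⟨ %-distribˡ-+ a b m ⟨
    (a + b) % m              ∎
    where open ≡-Reasoning

  shift-shift : ∀ e e' i → shift e (shift e' i) ≡ shift (e' + e) i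
  shift-shift e e' i = Fin.toℕ-injective (begin
    toℕ (shift e (shift e' i))   ≡⟨ toℕ-shift e _ ⟩
    (toℕ (shift e' i) + e) % m   ≡⟨ cong (λ c → (c + e) % m) (toℕ-shift e' i) ⟩
    ((toℕ i + e') % m + e) % m   ≡⟨ [a%m+b]%m≡[a+b]%m (toℕ i + e') e ⟩
    (toℕ i + e' + e) % m         ≡⟨ cong (_% m) (+-assoc (toℕ i) e' e) ⟩
    (toℕ i + (e' + e)) % m       ≡⟨ toℕ-shift (e' + e) i ⟨
    toℕ (shift (e' + e) i)       ∎)
    where open ≡-Reasoning

  shift-zero : ∀ i → shift 0 i ≡ i
  shift-zero i = Fin.toℕ-injective
    (trans (toℕ-shift 0 i) (trans (cong (_% m) (+-identityʳ (toℕ i))) (toℕ[i]%m≡toℕ[i] i)))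

  shift-period : ∀ i → shift m i ≡ i
  shift-period i = Fin.toℕ-injective
    (trans (toℕ-shift m i) (trans ([m+n]%n≡m%n (toℕ i) m) (toℕ[i]%m≡toℕ[i] i)))

  iterate-next : ∀ x e → iterate next x e ≡ shift e x
  iterate-next x zero    = sym (shift-zero x)
  iterate-next x (suc e) = trans (iterate-next (next x) e) (shift-shift e 1 x)

  -- x + d either stays below m or wraps around to x + d ∸ m; as 0 < d < m neither equals x
  shift-aperiodic : ∀ {d} x → 0 < d → d < m → shift d x ≢ x
  shift-aperiodic {d} x 0<d d<m dx≡x with toℕ x + d <? m
  ... | yes x+d<m = <-irrefl (sym x+d≡x) (m<m+n (toℕ x) 0<d)
    where
    x+d≡x : toℕ x + d ≡ toℕ x
    x+d≡x = trans (sym (m<n⇒m%n≡m x+d<m)) (trans (sym (toℕ-shift d x)) (cong toℕ dx≡x))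
  ... | no x+d≮m = <-irrefl (+-cancelˡ-≡ (toℕ x) d m x+d≡x+m) d<m
    where
    open ≡-Reasoning
    m≤x+d = ≮⇒≥ x+d≮m
    x+d∸m<m : toℕ x + d ∸ m < m
    x+d∸m<m = +-cancelʳ-< m _ m (subst (_< m + m) (sym (m∸n+n≡m m≤x+d)) (+-mono-< (Fin.toℕ<n x) d<m))
    x+d≡x+m : toℕ x + d ≡ toℕ x + m
    x+d≡x+m = begin
      toℕ x + d               ≡⟨ m∸n+n≡m m≤x+d ⟨
      (toℕ x + d ∸ m) + m     ≡⟨ cong (_+ m) (m<n⇒m%n≡m x+d∸m<m) ⟨
      (toℕ x + d ∸ m) % m + m ≡⟨ cong (_+ m) (m≤n⇒[n∸m]%m≡n%m m≤x+d) ⟩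
      (toℕ x + d) % m + m     ≡⟨ cong (_+ m) (trans (sym (toℕ-shift d x)) (cong toℕ dx≡x)) ⟩
      toℕ x + m               ∎

  shift-transitive : ∀ a b → Σ ℕ λ j → j < m × shift j a ≡ b
  shift-transitive a b = j % m , m%n<n j m , Fin.toℕ-injective (begin
    toℕ (shift (j % m) a)          ≡⟨ toℕ-shift (j % m) a ⟩
    (toℕ a + j % m) % m            ≡⟨ cong (_% m) (+-comm (toℕ a) (j % m)) ⟩
    (j % m + toℕ a) % m            ≡⟨ [a%m+b]%m≡[a+b]%m j (toℕ a) ⟩
    (j + toℕ a) % m                ≡⟨ cong (_% m) j+a≡b+m ⟩
    (toℕ b + m) % m                ≡⟨ [m+n]%n≡m%n (toℕ b) m ⟩
    toℕ b % m                      ≡⟨ toℕ[i]%m≡toℕ[i] b ⟩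
    toℕ b                          ∎)
    where
    open ≡-Reasoning
    j = toℕ b + (m ∸ toℕ a)
    j+a≡b+m : j + toℕ a ≡ toℕ b + m
    j+a≡b+m = trans (+-assoc (toℕ b) _ _) (cong (toℕ b +_) (m∸n+n≡m (<⇒≤ (Fin.toℕ<n a))))

  isCyclicPermutation : IsCyclicPermutation next prev m
  isCyclicPermutation = record
    { left-inverse  = λ x → trans (shift-shift _ 1 x) (trans (cong (λ e → shift e x) (suc-pred m)) (shift-period x))
    ; right-inverse = λ x → trans (shift-shift 1 _ x)
        (trans (cong (λ e → shift e x) (trans (+-comm _ 1) (suc-pred m))) (shift-period x))
    ; period        = λ x → trans (iterate-next x m) (shift-period x)
    ; aperiodic     = λ x 0<d d<m → shift-aperiodic x 0<d d<m ∘′ trans (sym (iterate-next x _))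
    ; transitive    = λ a b → let j , j<m , ja≡b = shift-transitive a b
                              in j , j<m , trans (iterate-next a j) ja≡b
    }

  nextIdx-next : ∀ i → NextIdx i (next i)
  nextIdx-next i with suc (toℕ i) <? m
  ... | yes 1+i<m = inj₁ (sym (trans (toℕ-next i) (m<n⇒m%n≡m 1+i<m)))
  ... | no 1+i≮m  = inj₂ (1+i≡m , trans (toℕ-next i) (trans (cong (_% m) 1+i≡m) (n%n≡0 m)))
    where 1+i≡m = ≤-antisym (Fin.toℕ<n i) (≮⇒≥ 1+i≮m)

  nextIdx⇒next : ∀ {i j} → NextIdx i j → next i ≡ j
  nextIdx⇒next {i} {j} (inj₁ 1+i≡j) = Fin.toℕ-injective
    (trans (toℕ-next i) (trans (cong (_% m) 1+i≡j) (toℕ[i]%m≡toℕ[i] j)))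
  nextIdx⇒next {i} {j} (inj₂ (1+i≡m , j≡0)) = Fin.toℕ-injective
    (trans (toℕ-next i) (trans (cong (_% m) 1+i≡m) (trans (n%n≡0 m) (sym j≡0))))

module _ {n : ℕ} {G : Graph n} {m : ℕ} (C : Cycle G m) where

  cedge-sym : ∀ {a b} → CEdge C a b → CEdge C b a
  cedge-sym (i , j , i→j , inj₁ (a≡i , b≡j)) = i , j , i→j , inj₂ (b≡j , a≡i)
  cedge-sym (i , j , i→j , inj₂ (a≡j , b≡i)) = i , j , i→j , inj₁ (b≡i , a≡j)

  cedge⇒edge : ∀ {a b} → CEdge C a b → Edge G a b
  cedge⇒edge (i , j , i→j , inj₁ (refl , refl)) = edges C i j i→j
  cedge⇒edge (i , j , i→j , inj₂ (refl , refl)) = trans (Graph.sym G _ _) (edges C i j i→j)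

  liesIn-++⁻ˡ : ∀ {a b} (p : Vec (Fin n) (suc a)) (q : Vec (Fin n) b) → LiesIn C (p ++ q) → LiesIn C p
  liesIn-++⁻ˡ p q (inC , chain) = All.++ˡ⁻ p inC , chain-++⁻ˡ p chain
    where
    chain-++⁻ˡ : ∀ {a} (p : Vec (Fin n) (suc a)) → Chain (CEdge C) (p ++ q) → Chain (CEdge C) p
    chain-++⁻ˡ (_ ∷ [])     _            = tt
    chain-++⁻ˡ (_ ∷ y ∷ ys) (e , chain) = e , chain-++⁻ˡ (y ∷ ys) chain

  arc : (Fin m → Fin m) → Fin m → (l : ℕ) → Vec (Fin n) (suc l)
  arc f x zero    = vtx C x ∷ []
  arc f x (suc l) = vtx C x ∷ arc f (f x) l

  lookup-arc : ∀ f x l (i : Fin (suc l)) → lookup (arc f x l) i ≡ vtx C (iterate f x (toℕ i))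
  lookup-arc f x zero    zero    = refl
  lookup-arc f x (suc l) zero    = refl
  lookup-arc f x (suc l) (suc i) = lookup-arc f (f x) l i

  last-arc : ∀ f x l → last (arc f x l) ≡ vtx C (iterate f x l)
  last-arc f x zero          = refl
  last-arc f x (suc zero)    = refl
  last-arc f x (suc (suc l)) = last-arc f (f x) (suc l)

  arc-inC : ∀ f x l → All (InC C) (arc f x l)
  arc-inC f x zero    = (x , refl) ∷ []
  arc-inC f x (suc l) = (x , refl) ∷ arc-inC f (f x) l

  geodesic-liesIn : ∀ {u v k} → Dist G u v k → CPathUniqueShortest C u v k →
                    ∀ W → IsPath G u v k W → LiesIn C W
  geodesic-liesIn dist (P , _ , P-liesIn , unique) W W-path with unique _ W (W-path , dist)
  ... | refl , refl = P-liesIn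

  unique-geodesic : ∀ {u v k} {P : Vec (Fin n) (suc k)} → IsPath G u v k P → LiesIn C P → Dist G u v k →
    (∀ Q → IsPath G u v k Q → Q ≡ P) → CPathUniqueShortest C u v k
  unique-geodesic P-path P-liesIn dist unique = _ , P-path , P-liesIn , λ l Q geodesic →
    case Walks.dist-unique G (proj₂ geodesic) dist of λ { refl → refl , unique Q (proj₁ geodesic) }

  exactly-two-paths-cover : ∀ {u v k} {A B : Vec (Fin n) (suc k)} → ExactlyTwoPaths C u v k →
    IsPath G u v k A → IsPath G u v k B → A ≢ B → ∀ W → IsPath G u v k W → W ≡ A ⊎ W ≡ B
  exactly-two-paths-cover (P₁ , P₂ , _ , _ , P₁≢P₂ , cover) A-path B-path A≢B W W-path
    with cover _ A-path | cover _ B-path | cover W W-path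
  ... | inj₁ refl | inj₁ refl | _         = ⊥-elim (A≢B refl)
  ... | inj₂ refl | inj₂ refl | _         = ⊥-elim (A≢B refl)
  ... | inj₁ refl | inj₂ refl | W≡P₁or₂   = W≡P₁or₂
  ... | inj₂ refl | inj₁ refl | W≡P₂or₁   = Sum.swap W≡P₂or₁

record Orientation {n : ℕ} {G : Graph n} {m : ℕ} (C : Cycle G m) : Set where
  field
    next prev           : Fin m → Fin m
    isCyclicPermutation : IsCyclicPermutation next prev m
    cedge-next          : ∀ x → CEdge C (vtx C x) (vtx C (next x))
    cedge-neighbour     : ∀ x w → CEdge C (vtx C x) w → w ≡ vtx C (next x) ⊎ w ≡ vtx C (prev x)

reverse-orientation : ∀ {n} {G : Graph n} {m} {C : Cycle G m} → Orientation C → Orientation C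
reverse-orientation {C = C} O = record
  { next                = prev
  ; prev                = next
  ; isCyclicPermutation = CyclicPermutation.reverse isCyclicPermutation
  ; cedge-next          = λ x → subst (λ y → CEdge C (vtx C y) (vtx C (prev x))) (right-inverse x)
                                      (cedge-sym C (cedge-next (prev x)))
  ; cedge-neighbour     = λ x w e → Sum.swap (cedge-neighbour x w e)
  }
  where open Orientation O
        open IsCyclicPermutation isCyclicPermutation

module OrientedArcs {n : ℕ} {G : Graph n} {m : ℕ} {C : Cycle G m} (O : Orientation C) where
  open Orientation O
  open CyclicPermutation isCyclicPermutation
  open Walks G

  arc-walk : ∀ x l → IsWalk G (vtx C x) (vtx C (iterate next x l)) l (arc C next x l)
  arc-walk x zero    = refl , refl , tt
  arc-walk x (suc l) = walk-∷ (cedge⇒edge C (cedge-next x)) (arc-walk (next x) l)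

  arc-liesIn : ∀ x l → LiesIn C (arc C next x l)
  arc-liesIn x l = arc-inC C next x l , arc-chain x l
    where
    arc-chain : ∀ x l → Chain (CEdge C) (arc C next x l)
    arc-chain x zero          = tt
    arc-chain x (suc zero)    = cedge-next x , tt
    arc-chain x (suc (suc l)) = cedge-next x , arc-chain (next x) (suc l)

  arc-path : ∀ x l → l < m → IsPath G (vtx C x) (vtx C (iterate next x l)) l (arc C next x l)
  arc-path x l l<m = arc-walk x l , λ {i} {j} arcᵢ≡arcⱼ → Fin.toℕ-injective
    (iterate-injective (index<m i) (index<m j) (distinct C
      (trans (sym (lookup-arc C next x l i)) (trans arcᵢ≡arcⱼ (lookup-arc C next x l j)))))
    where
    index<m : ∀ (i : Fin (suc l)) → toℕ i < m
    index<m i = ≤-<-trans (Fin.toℕ≤pred[n] i) l<m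

  no-u-turn : ∀ x l (ys : Vec (Fin n) (suc l)) → Injective _≡_ _≡_ (lookup (vtx C x ∷ ys)) →
              ys ≡ arc C prev (next x) l → ys ≡ arc C next (next x) l
  no-u-turn x zero    _ _ refl = refl
  no-u-turn x (suc l) _ injective refl
    with injective {zero} {suc (suc zero)}
           (sym (trans (lookup-arc C prev (next x) (suc l) (suc zero)) (cong (vtx C) (left-inverse x))))
  ... | ()

  ConvexArc : ℕ → Fin m → Set
  ConvexArc k a = Dist G (vtx C a) (vtx C (iterate next a k)) k ×
                  (∀ W → IsPath G (vtx C a) (vtx C (iterate next a k)) k W → LiesIn C W)

  -- Prolonged along C from next^j a to next^k a, a geodesic to next^j a becomes a walk of length
  -- at most k, hence a geodesic of length k, which lies in C.
  convexArc-prefix : ∀ {k a} → ConvexArc k a → ∀ {j} → j ≤ k →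
    ∀ l Q → IsShortestPath G (vtx C a) (vtx C (iterate next a j)) l Q → LiesIn C Q
  convexArc-prefix {k} {a} (dist , liesIn) {j} j≤k l Q ((Q-walk , _) , (_ , Q-minimal)) =
    liesIn-++⁻ˡ C Q (tail R) (length-k-liesIn W-length _ (W-walk , minimal-walk-injective W-minimal W-walk))
    where
    b = vtx C (iterate next a k)
    R = arc C next (iterate next a j) (k ∸ j)
    R-walk : IsWalk G (vtx C (iterate next a j)) b (k ∸ j) R
    R-walk = subst (λ y → IsWalk G _ (vtx C y) (k ∸ j) R)
      (trans (sym (iterate-+ next a j (k ∸ j))) (cong (iterate next a) (m+[n∸m]≡n j≤k)))
      (arc-walk (iterate next a j) (k ∸ j))
    W-walk = walk-++ Q-walk R-walk
    W-length : l + (k ∸ j) ≡ k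
    W-length = ≤-antisym
      (≤-trans (+-monoˡ-≤ (k ∸ j) (Q-minimal j _ (arc-walk a j))) (≤-reflexive (m+[n∸m]≡n j≤k)))
      (proj₂ dist _ _ W-walk)
    W-minimal : ∀ l' q → IsWalk G (vtx C a) b l' q → l + (k ∸ j) ≤ l'
    W-minimal l' q q-walk = subst (_≤ l') (sym W-length) (proj₂ dist l' q q-walk)
    length-k-liesIn : ∀ {L} → L ≡ k → ∀ W → IsPath G (vtx C a) b L W → LiesIn C W
    length-k-liesIn refl = liesIn

module TwoWayArcs {n : ℕ} {G : Graph n} {m : ℕ} {C : Cycle G m} (O : Orientation C) where
  open Orientation O
  open CyclicPermutation isCyclicPermutation
  open Walks G
  open OrientedArcs O public
  module Back = OrientedArcs (reverse-orientation O)

  cycle-path-is-arc : ∀ l (p : Vec (Fin n) (suc l)) x → head p ≡ vtx C x → Chain (CEdge C) p →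
    Injective _≡_ _≡_ (lookup p) → p ≡ arc C next x l ⊎ p ≡ arc C prev x l
  cycle-path-is-arc zero (_ ∷ []) x refl _ _ = inj₁ refl
  cycle-path-is-arc (suc l) (_ ∷ y ∷ ys) x refl (e , chain) injective with cedge-neighbour x y e
  ... | inj₁ refl = inj₁ (cong (vtx C x ∷_) (Sum.[ id , no-u-turn x l (y ∷ ys) injective ]
          (cycle-path-is-arc l (y ∷ ys) (next x) refl chain (lookup-∷-injective injective))))
  ... | inj₂ refl = inj₂ (cong (vtx C x ∷_) (Sum.[ Back.no-u-turn x l (y ∷ ys) injective , id ]
          (cycle-path-is-arc l (y ∷ ys) (prev x) refl chain (lookup-∷-injective injective))))

  arc-endpoint : ∀ {x t k} → CPathUniqueShortest C (vtx C x) (vtx C t) k →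
                 t ≡ iterate next x k ⊎ t ≡ iterate prev x k
  arc-endpoint {x} {t} {k} (P , ((start , end , _) , injective) , (_ , chain) , _)
    with cycle-path-is-arc k P x start chain injective
  ... | inj₁ refl = inj₁ (distinct C (trans (sym end) (last-arc C next x k)))
  ... | inj₂ refl = inj₂ (distinct C (trans (sym end) (last-arc C prev x k)))

  convex-geodesic-is-arc : Convex C → ∀ a t d Q → IsShortestPath G (vtx C a) (vtx C t) d Q →
    (Q ≡ arc C next a d × iterate next a d ≡ t) ⊎ (Q ≡ arc C prev a d × iterate prev a d ≡ t)
  convex-geodesic-is-arc convex a t d Q geodesic@(((start , end , _) , injective) , _)
    with cycle-path-is-arc d Q a start (proj₂ (convex _ _ (a , refl) (t , refl) d Q geodesic)) injective
  ... | inj₁ refl = inj₁ (refl , distinct C (trans (sym (last-arc C next a d)) end))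
  ... | inj₂ refl = inj₂ (refl , distinct C (trans (sym (last-arc C prev a d)) end))

  convex-arc-dist : Convex C → ∀ k a → k < m →
    (∀ {d} → d ≤ k → iterate prev a d ≡ iterate next a k → d ≡ k) →
    Dist G (vtx C a) (vtx C (iterate next a k)) k
  convex-arc-dist convex k a k<m backward-only-at-k with dist-exists (arc-walk a k)
  ... | d , dist@((Q , Q-path) , minimal) with minimal k _ (arc-walk a k)
  ... | d≤k with convex-geodesic-is-arc convex a _ d Q (Q-path , dist)
  ... | inj₁ (_ , forward)  = subst (Dist G _ _) (iterate-injective (≤-<-trans d≤k k<m) k<m forward) dist
  ... | inj₂ (_ , backward) = subst (Dist G _ _) (backward-only-at-k d≤k backward) dist

  convex-odd-arc : Convex C → ∀ {k} → 1 ≤ k → m ≡ 2 * k + 1 → ∀ a →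
    Dist G (vtx C a) (vtx C (iterate next a k)) k ×
    CPathUniqueShortest C (vtx C a) (vtx C (iterate next a k)) k
  convex-odd-arc convex {k} 1≤k m≡2k+1 a = dist , unique-geodesic C (arc-path a k k<m) (arc-liesIn a k) dist unique
    where
    k<m = subst (k <_) (sym m≡2k+1) (k<2k+1 k)
    not-backward : ∀ {d} → d ≤ k → iterate prev a d ≢ iterate next a k
    not-backward d≤k meet = d+k≢2k+1 k d≤k (trans (backward-meets-forward a d≤k 1≤k k<m meet) m≡2k+1)
    dist = convex-arc-dist convex k a k<m (λ d≤k meet → ⊥-elim (not-backward d≤k meet))
    unique : ∀ Q → IsPath G (vtx C a) (vtx C (iterate next a k)) k Q → Q ≡ arc C next a k
    unique Q Q-path with convex-geodesic-is-arc convex a _ k Q (Q-path , dist)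
    ... | inj₁ (Q≡arc , _)  = Q≡arc
    ... | inj₂ (_ , backward) = ⊥-elim (not-backward ≤-refl backward)

  arcs-distinct : ∀ a {k} → 1 ≤ k → arc C next a k ≢ arc C prev a k
  arcs-distinct a {suc k} _ arcs≡ = aperiodic a z<s (length≥3 C)
    (trans (cong next (distinct C next≡prev)) (right-inverse a))
    where
    next≡prev : vtx C (next a) ≡ vtx C (prev a)
    next≡prev = trans (sym (lookup-arc C next a (suc k) (suc zero)))
      (trans (cong (λ p → lookup p (suc zero)) arcs≡) (lookup-arc C prev a (suc k) (suc zero)))

  backward-arc-path-even : ∀ {k} → 1 ≤ k → m ≡ 2 * k → ∀ a →
    IsPath G (vtx C a) (vtx C (iterate next a k)) k (arc C prev a k)
  backward-arc-path-even {k} 1≤k m≡2k a = subst (λ y → IsPath G (vtx C a) (vtx C y) k (arc C prev a k))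
    (even-antipode a 1≤k m≡2k) (Back.arc-path a k (subst (k <_) (sym m≡2k) (k<2k k 1≤k)))

  convex-even-arc : Convex C → ∀ {k} → 2 ≤ k → m ≡ 2 * k → ∀ a →
    Dist G (vtx C a) (vtx C (iterate next a k)) k × ExactlyTwoPaths C (vtx C a) (vtx C (iterate next a k)) k
  convex-even-arc convex {k} 2≤k m≡2k a =
    dist , arc C next a k , arc C prev a k , arc-path a k k<m , backward-arc-path-even 1≤k m≡2k a ,
    arcs-distinct a 1≤k , cover
    where
    1≤k = ≤-trans (s≤s z≤n) 2≤k
    k<m = subst (k <_) (sym m≡2k) (k<2k k 1≤k)
    dist = convex-arc-dist convex k a k<m λ d≤k meet →
      d+k≡2k⇒d≡k k (trans (backward-meets-forward a d≤k 1≤k k<m meet) m≡2k)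
    cover : ∀ Q → IsPath G (vtx C a) (vtx C (iterate next a k)) k Q → Q ≡ arc C next a k ⊎ Q ≡ arc C prev a k
    cover Q Q-path = Sum.map proj₁ proj₁ (convex-geodesic-is-arc convex a _ k Q (Q-path , dist))

  -- Each arc ends k steps forward or backward; every combination other than next^k y = prev^k x
  -- forces x ≡ y or 2k − 1 ≡ 0 modulo 2k + 1.
  odd-apex : ∀ {k} → 1 ≤ k → m ≡ 2 * k + 1 → ∀ {x y t} → next x ≡ y →
    CPathUniqueShortest C (vtx C x) (vtx C t) k → CPathUniqueShortest C (vtx C y) (vtx C t) k →
    t ≡ iterate next y k
  odd-apex {suc k} 1≤k m≡2k+1 {x} {t = t} refl from-x from-y = apex (arc-endpoint from-x) (arc-endpoint from-y)
    where
    k<m = subst (suc k <_) (sym m≡2k+1) (k<2k+1 (suc k))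
    back-step : iterate prev (next x) (suc k) ≡ iterate prev x k
    back-step = cong (λ z → iterate prev z k) (left-inverse x)
    apex : t ≡ iterate next x (suc k) ⊎ t ≡ iterate prev x (suc k) →
           t ≡ iterate next (next x) (suc k) ⊎ t ≡ iterate prev (next x) (suc k) →
           t ≡ iterate next (next x) (suc k)
    apex _ (inj₁ t≡nextʸ) = t≡nextʸ
    apex (inj₁ t≡nextˣ) (inj₂ t≡prevʸ) = ⊥-elim (d+k≢2k+1 (suc k) (n≤1+n k)
      (trans (backward-meets-forward x (n≤1+n k) z<s k<m (trans (sym (trans t≡prevʸ back-step)) t≡nextˣ))
             m≡2k+1))
    apex (inj₂ t≡prevˣ) (inj₂ t≡prevʸ) = ⊥-elim (1+n≢n
      (CyclicPermutation.iterate-injective reverse k<m (≤-<-trans (n≤1+n k) k<m)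
        (trans (sym t≡prevˣ) (trans t≡prevʸ back-step))))

  odd-apex-convexArc : ∀ {k} → 1 ≤ k → m ≡ 2 * k + 1 → ∀ {x a t} → next x ≡ a →
    Dist G (vtx C a) (vtx C t) k →
    CPathUniqueShortest C (vtx C x) (vtx C t) k → CPathUniqueShortest C (vtx C a) (vtx C t) k →
    ConvexArc k a
  odd-apex-convexArc 1≤k m≡2k+1 x→a dist from-x from-a with odd-apex 1≤k m≡2k+1 x→a from-x from-a
  ... | refl = dist , geodesic-liesIn C dist from-a

  even-dist-antipode : ∀ {k} → m ≡ 2 * k → ∀ {a t} → Dist G (vtx C a) (vtx C t) k → t ≡ iterate next a k
  even-dist-antipode {k} m≡2k {a} {t} dist with transitive a t
  ... | e , e<m , refl = cong (iterate next a) e≡k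
    where
    k≤e : k ≤ e
    k≤e = proj₂ dist e _ (arc-walk a e)
    k≤m∸e : k ≤ m ∸ e
    k≤m∸e = proj₂ dist (m ∸ e) _
      (subst (λ y → IsWalk G (vtx C a) (vtx C y) (m ∸ e) (arc C prev a (m ∸ e)))
             (iterate-complement a (<⇒≤ e<m)) (Back.arc-walk a (m ∸ e)))
    e≡k : e ≡ k
    e≡k = ≤-antisym (≡2k⇒≤k k m≡2k (<⇒≤ e<m) k≤m∸e) k≤e

  even-convexArc : ∀ {k} → 2 ≤ k → m ≡ 2 * k → EvenCondition C k → ∀ a → ConvexArc k a
  even-convexArc {k} 2≤k m≡2k even a with even a
  ... | t , dist , two with even-dist-antipode m≡2k dist
  ... | refl = dist , λ W W-path → Sum.[ (λ { refl → arc-liesIn a k }) , (λ { refl → Back.arc-liesIn a k }) ]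
      (exactly-two-paths-cover C two (arc-path a k k<m) (backward-arc-path-even 1≤k m≡2k a) (arcs-distinct a 1≤k)
        W W-path)
    where
    1≤k = ≤-trans (s≤s z≤n) 2≤k
    k<m = subst (k <_) (sym m≡2k) (k<2k k 1≤k)

  convex-from-arcs : ∀ {k} → m ≤ 2 * k + 1 →
    (∀ a → ConvexArc k a) → (∀ a → Back.ConvexArc k a) → Convex C
  convex-from-arcs {k} m≤2k+1 forward backward _ _ (a , refl) (b , refl) l Q geodesic with transitive a b
  ... | j , j<m , refl with j ≤? k
  ... | yes j≤k = convexArc-prefix (forward a) j≤k l Q geodesic
  ... | no j≰k  = Back.convexArc-prefix (backward a) (≤2k+1⇒∸≤k k m≤2k+1 (≰⇒> j≰k)) l Q
        (subst (λ y → IsShortestPath G (vtx C a) (vtx C y) l Q) (sym (iterate-complement a (<⇒≤ j<m))) geodesic)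

module StandardOrientation {n : ℕ} {G : Graph n} {m : ℕ} .{{_ : NonZero m}} (C : Cycle G m) where
  open Rotation m
  open CyclicPermutation isCyclicPermutation

  orientation : Orientation C
  orientation = record
    { next                = next
    ; prev                = prev
    ; isCyclicPermutation = isCyclicPermutation
    ; cedge-next          = λ x → x , next x , nextIdx-next x , inj₁ (refl , refl)
    ; cedge-neighbour     = neighbour
    }
    where
    neighbour : ∀ x w → CEdge C (vtx C x) w → w ≡ vtx C (next x) ⊎ w ≡ vtx C (prev x)
    neighbour x _ (i , j , i→j , inj₁ (x≡i , refl)) with distinct C x≡i
    ... | refl = inj₁ (cong (vtx C) (sym (nextIdx⇒next i→j)))
    neighbour x _ (i , j , i→j , inj₂ (x≡j , refl)) with distinct C x≡j
    ... | refl = inj₂ (cong (vtx C) (trans (sym (left-inverse i)) (cong prev (nextIdx⇒next i→j))))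

  open TwoWayArcs orientation
  module Reversed = TwoWayArcs (reverse-orientation orientation)

  odd-characterisation : ∀ k → 1 ≤ k → m ≡ 2 * k + 1 → Convex C ⇔ OddCondition C k
  odd-characterisation k 1≤k m≡2k+1 = mk⇔ convex⇒odd odd⇒convex
    where
    convex⇒odd : Convex C → OddCondition C k
    convex⇒odd convex i j i→j
      with nextIdx⇒next i→j
         | Reversed.convex-odd-arc convex 1≤k m≡2k+1 i | convex-odd-arc convex 1≤k m≡2k+1 (next i)
    ... | refl | dist-i , from-i | dist-j , from-j =
      iterate next (next i) k ,
      subst (λ t → Dist G (vtx C i) (vtx C t) k) (odd-antipode i {k} m≡2k+1) dist-i , dist-j ,
      subst (λ t → CPathUniqueShortest C (vtx C i) (vtx C t) k) (odd-antipode i {k} m≡2k+1) from-i , from-j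
    odd⇒convex : OddCondition C k → Convex C
    odd⇒convex odd = convex-from-arcs (≤-reflexive m≡2k+1) forward backward
      where
      forward : ∀ a → ConvexArc k a
      forward a with odd (prev a) a (subst (NextIdx (prev a)) (right-inverse a) (nextIdx-next (prev a)))
      ... | _ , _ , dist-a , from-prev-a , from-a =
        odd-apex-convexArc 1≤k m≡2k+1 (right-inverse a) dist-a from-prev-a from-a
      backward : ∀ a → Back.ConvexArc k a
      backward a with odd a (next a) (nextIdx-next a)
      ... | _ , dist-a , _ , from-a , from-next-a =
        Reversed.odd-apex-convexArc 1≤k m≡2k+1 (left-inverse a) dist-a from-next-a from-a

  even-characterisation : ∀ k → 2 ≤ k → m ≡ 2 * k → Convex C ⇔ EvenCondition C k
  even-characterisation k 2≤k m≡2k = mk⇔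
    (λ convex s → iterate next s k , convex-even-arc convex 2≤k m≡2k s)
    (λ even → convex-from-arcs (subst (_≤ 2 * k + 1) (sym m≡2k) (m≤m+n (2 * k) 1))
                (even-convexArc 2≤k m≡2k even) (Reversed.even-convexArc 2≤k m≡2k even))

mainTheorem3 : ∀ {n} (G : Graph n) → Connected G → ∀ {m} (C : Cycle G m) →
    (∀ k → 1 ≤ k → m ≡ 2 * k + 1 → (Convex C ⇔ OddCondition C k))
  × (∀ k → 2 ≤ k → m ≡ 2 * k → (Convex C ⇔ EvenCondition C k))
mainTheorem3 G _ {zero}  C with length≥3 C
... | ()
mainTheorem3 G _ {suc m} C = odd-characterisation , even-characterisation
  where open StandardOrientation C
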